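{- For each model $M$ of a frame-logic signature, there is a unique frame model over the same universe with the same interpretation of the constants, the functions, and the non-inductive relations (those in $\mathcal R$) as $M$.
   Context: Frame logic (FL). Fix a multi-sorted signature with a finite set $S$ of sorts, constant symbols, function symbols, and two disjoint sets of relation symbols: ordinary relations $\mathcal R$ and inductively defined relations $\mathcal I$. $S$ contains a foreground sort $\sigma_{\mathsf f}$ and a background sort $\sigma_{\mathsf{S(f)}}$ whose universe is always the powerset of the universe $U_{\sigma_{\mathsf f}}$; the only symbols involving $\sigma_{\mathsf{S(f)}}$ are $\in,\cup,\cap$, complement and $\emptyset$ with their usual meaning. A subset $F_{\mathsf m}$ of function symbols is mutable; each has at least one argument of sort $\sigma_{\mathsf f}$. Syntax. Guards: $\gamma ::= t=t \mid R(\bar t)\ (R\in\mathcal R) \mid \gamma\wedge\gamma \mid \neg\gamma \mid \mathit{ite}(\gamma:\gamma,\gamma)\mid \exists y{:}\gamma.\gamma$, with all terms in guards of sorts other than $\sigma_{\mathsf{S(f)}}$. Formulas: $\varphi ::= t=t \mid R(\bar t)\ (R\in\mathcal R\cup\mathcal I)\mid \varphi\wedge\varphi\mid\neg\varphi\mid \mathit{ite}(\gamma:\varphi,\varphi)\mid \exists y{:}\gamma.\varphi$. Terms: $t ::= c \mid x \mid f(\bar t)\mid \mathit{ite}(\gamma:t,t)\mid \mathit{Sp}(\varphi)\mid\mathit{Sp}(t)$ (support expressions, of sort $\sigma_{\mathsf{S(f)}}$). Each $R\in\mathcal I$ has a definition $R(\bar x):=\rho_R(\bar x)$, no argument of $R$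 of sort $\sigma_{\mathsf{S(f)}}$, and relations of $\mathcal I$ occur in $\rho_R$ only positively or inside support expressions. Models. A model gives universes per sort, interprets constants, functions and all relations (respecting background theories), and interprets each support expression as a map from variable assignments $\nu$ to subsets of $U_{\sigma_{\mathsf f}}$; truth and term values are standard, with $\exists y{:}\gamma.\varphi\equiv\exists y.(\gamma\wedge\varphi)$ and $\mathit{ite}(\gamma:\alpha,\beta)\equiv(\gamma\wedge\alpha)\vee(\neg\gamma\wedge\beta)$. Support equations (writing $\mathrm{Sp}(e)(\nu)=[\![\mathit{Sp}(e)]\!]^M(\nu)$): $\mathrm{Sp}(c)=\mathrm{Sp}(x)=\emptyset$; $\mathrm{Sp}(f(t_1..t_n))(\nu)=\{[\![t_i]\!]^{M,\nu}: t_i$ of sort $\sigma_{\mathsf f}\}\cup\bigcup_i\mathrm{Sp}(t_i)(\nu)$ if $f\in F_{\mathsf m}$, else $\bigcup_i\mathrm{Sp}(t_i)(\nu)$; $\mathrm{Sp}(\mathit{Sp}(e))=\mathrm{Sp}(e)$; $\mathrm{Sp}(t_1=t_2)=\mathrm{Sp}(t_1)\cup\mathrm{Sp}(t_2)$; $\mathrm{Sp}(R(\bar t))=\bigcup_i\mathrm{Sp}(t_i)$ for $R\in\mathcal R$; $\mathrm{Sp}(R(\bar t))(\nu)=\mathrm{Sp}(\rho_R(\bar x))(\nu[\bar x\leftarrow[\![\bar t]\!]^{M,\nu}])\cup\bigcup_i\mathrm{Sp}(t_i)(\nu)$ for $R\in\mathcal I$; $\mathrm{Sp}(\alpha\wedge\beta)=\mathrm{Sp}(\alpha)\cup\mathrm{Sp}(\beta)$;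 $\mathrm{Sp}(\neg\varphi)=\mathrm{Sp}(\varphi)$; $\mathrm{Sp}(\mathit{ite}(\gamma:e_1,e_2))(\nu)=\mathrm{Sp}(\gamma)(\nu)\cup\mathrm{Sp}(e_1)(\nu)$ if $M,\nu\models\gamma$, else $\mathrm{Sp}(\gamma)(\nu)\cup\mathrm{Sp}(e_2)(\nu)$; $\mathrm{Sp}(\exists y{:}\gamma.\varphi)(\nu)=\bigcup_{u\in D_y}\mathrm{Sp}(\gamma)(\nu[y\leftarrow u])\cup\bigcup_{u\in D_y,M,\nu[y\leftarrow u]\models\gamma}\mathrm{Sp}(\varphi)(\nu[y\leftarrow u])$. Inductive equations: $[\![R]\!]^M=\{\bar u: M,[\bar x\leftarrow\bar u]\models\rho_R(\bar x)\}$ for $R\in\mathcal I$. Frame models. A pre-model is like a model without interpretations of $\mathcal I$ and support expressions; $\mathrm{Mod}(\hat M)$ is the set of models extending pre-model $\hat M$. For $M_1,M_2\in\mathrm{Mod}(\hat M)$: $M_1\le_{\mathrm f}M_2$ iff every support expression's interpretation in $M_1$ is pointwise contained in that of $M_2$; $<_{\mathrm f}$ means $\le_{\mathrm f}$ but not $\ge_{\mathrm f}$; $M_1\le_{\mathrm i}M_2$ iff they agree on all support expressions and $[\![I]\!]^{M_1}\subseteq[\![I]\!]^{M_2}$ for all $I\in\mathcal I$, with $<_{\mathrm i}$ strict. $M\in\mathrm{Mod}(\hat M)$ is a frame model if it satisfies the support and inductive equations, no $M'<_{\mathrm f}M$ in $\mathrm{Mod}(\hat M)$ satisfies the support equations,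 and no $M'<_{\mathrm i}M$ in $\mathrm{Mod}(\hat M)$ satisfies the inductive equations. -}

module Defs where

-- Conventions:
--  * every "set" of the paper (a subset of a universe, the interpretation of a
--    relation, an element of the background powerset sort) is represented by its
--    characteristic function into Bool; equality of such sets is pointwise
--    equality of characteristic functions (set extensionality);
--  * the ambient mathematics is classical: the semantics is parameterised by an
--    excluded-middle oracle  em : ExcludedMiddle ℓ , used to evaluate the
--    if-then-else of the paper (term-level  ite  and the support equation of  ite ).

open import Level using (Level; Lift) renaming (suc to lsuc)
open import Data.Nat using (ℕ)
open import Data.Fin using (Fin)
open import Data.Bool using (Bool; true; false; T; if_then_else_; _∨_; _∧_; not)
open import Data.List using (List; []; _∷_; map)
open import Data.List.Membership.Propositional using (_∈_)
open import Data.List.Relation.Unary.All using (All; []; _∷_)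
open import Data.Empty using (⊥)
open import Data.Unit using (⊤)
open import Data.Sum using (_⊎_)
open import Data.Product using (Σ; _×_; _,_; Σ-syntax)
open import Relation.Nullary using (¬_; Dec; does)
open import Relation.Binary.PropositionalEquality using (_≡_)
open import Function.Bundles using (_⇔_)
open import Axiom.ExcludedMiddle using (ExcludedMiddle)

-- Sorts: a finite set containing the foreground sort fg, the background
-- sort bg (= powerset of the fg universe) and finitely many other sorts.

data Sort (n : ℕ) : Set where
  fg  : Sort n
  bg  : Sort n
  oth : Fin n → Sort n

data OSort (n : ℕ) : Set where
  ofg  : OSort n
  ooth : Fin n → OSort n

⌜_⌝ : ∀ {n} → OSort n → Sort n
⌜ ofg ⌝    = fg
⌜ ooth k ⌝ = oth k

-- Signatures.  The only symbols involving the background sort are the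
-- built-in  ∈, ∪, ∩, complement, ∅ ; hence all signature symbols have
-- argument / result sorts in OSort.

record Signature : Set₁ where
  field
    nOth       : ℕ
    Const      : Set
    constSort  : Const → OSort nOth
    Fun        : Set
    funArgs    : Fun → List (OSort nOth)
    funRes     : Fun → OSort nOth
    mutable    : Fun → Bool
    mutable-fg : ∀ f → T (mutable f) → ofg ∈ funArgs f
    Rel        : Set
    relArgs    : Rel → List (OSort nOth)
    Ind        : Set
    indArgs    : Ind → List (OSort nOth)

module Syntax (S : Signature) where
  open Signature S

  Srt : Set
  Srt = Sort nOth

  Ctx : Set
  Ctx = List Srt

  data _∋_ : Ctx → Srt → Set where
    here  : ∀ {Γ s}   → (s ∷ Γ) ∋ s
    there : ∀ {Γ s t} → Γ ∋ s → (t ∷ Γ) ∋ s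

  mutual
    data Term (Γ : Ctx) : Srt → Set where
      con  : (c : Const) → Term Γ ⌜ constSort c ⌝
      var  : ∀ {s} → Γ ∋ s → Term Γ s
      app  : (f : Fun) → Terms Γ (map ⌜_⌝ (funArgs f)) → Term Γ ⌜ funRes f ⌝
      tite : ∀ {s} → Guard Γ → Term Γ s → Term Γ s → Term Γ s
      spF  : Formula Γ → Term Γ bg
      spT  : ∀ {s} → Term Γ s → Term Γ bg
      emp  : Term Γ bg
      uni  : Term Γ bg → Term Γ bg → Term Γ bg
      int  : Term Γ bg → Term Γ bg → Term Γ bg
      cmp  : Term Γ bg → Term Γ bg

    data Terms (Γ : Ctx) : List Srt → Set where
      []  : Terms Γ []
      _∷_ : ∀ {s ss} → Term Γ s → Terms Γ ss → Terms Γ (s ∷ ss)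

    data Guard (Γ : Ctx) : Set where
      geq  : ∀ {o} → Term Γ ⌜ o ⌝ → Term Γ ⌜ o ⌝ → Guard Γ
      grel : (r : Rel) → Terms Γ (map ⌜_⌝ (relArgs r)) → Guard Γ
      gand : Guard Γ → Guard Γ → Guard Γ
      gneg : Guard Γ → Guard Γ
      gite : Guard Γ → Guard Γ → Guard Γ → Guard Γ
      gex  : (s : Srt) → Guard (s ∷ Γ) → Guard (s ∷ Γ) → Guard Γ

    data Formula (Γ : Ctx) : Set where
      feq  : ∀ {s} → Term Γ s → Term Γ s → Formula Γ
      frel : (r : Rel) → Terms Γ (map ⌜_⌝ (relArgs r)) → Formula Γ
      find : (i : Ind) → Terms Γ (map ⌜_⌝ (indArgs i)) → Formula Γ
      fmem : Term Γ fg → Term Γ bg → Formula Γ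
      fand : Formula Γ → Formula Γ → Formula Γ
      fneg : Formula Γ → Formula Γ
      fite : Guard Γ → Formula Γ → Formula Γ → Formula Γ
      fex  : (s : Srt) → Guard (s ∷ Γ) → Formula (s ∷ Γ) → Formula Γ

  ⌊_⌋ : ∀ {Γ} → Guard Γ → Formula Γ
  ⌊ geq t u ⌋     = feq t u
  ⌊ grel r ts ⌋   = frel r ts
  ⌊ gand γ δ ⌋    = fand ⌊ γ ⌋ ⌊ δ ⌋
  ⌊ gneg γ ⌋      = fneg ⌊ γ ⌋
  ⌊ gite γ δ ε ⌋  = fite γ ⌊ δ ⌋ ⌊ ε ⌋
  ⌊ gex s γ δ ⌋   = fex s γ ⌊ δ ⌋

  data SpExpr (Γ : Ctx) : Set where
    sF : Formula Γ → SpExpr Γ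
    sT : ∀ {s} → Term Γ s → SpExpr Γ

  IndDefs : Set
  IndDefs = (i : Ind) → Formula (map ⌜_⌝ (indArgs i))

  -- inductive relations occur only positively (outside support expressions)
  data Pol : Set where
    pos neg : Pol

  flipP : Pol → Pol
  flipP pos = neg
  flipP neg = pos

  Occ : ∀ {Γ} → Pol → Formula Γ → Set
  Occ p (feq t u)      = ⊤
  Occ p (frel r ts)    = ⊤
  Occ p (find i ts)    = p ≡ pos
  Occ p (fmem t u)     = ⊤
  Occ p (fand φ ψ)     = Occ p φ × Occ p ψ
  Occ p (fneg φ)       = Occ (flipP p) φ
  Occ p (fite γ φ ψ)   = Occ p φ × Occ p ψ
  Occ p (fex s γ φ)    = Occ p φ

  Positive : IndDefs → Set
  Positive ρ = ∀ i → Occ pos (ρ i)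

module Models (S : Signature) {ℓ : Level} where
  open Signature S
  open Syntax S

  ValOf : (Ufg : Set ℓ) → (Fin nOth → Set ℓ) → Srt → Set ℓ
  ValOf Ufg U fg      = Ufg
  ValOf Ufg U bg      = Ufg → Bool
  ValOf Ufg U (oth k) = U k

  record PreModel : Set (lsuc ℓ) where
    field
      Ufg   : Set ℓ
      Uoth  : Fin nOth → Set ℓ
      const : (c : Const) → ValOf Ufg Uoth ⌜ constSort c ⌝
      fun   : (f : Fun) → All (ValOf Ufg Uoth) (map ⌜_⌝ (funArgs f))
                        → ValOf Ufg Uoth ⌜ funRes f ⌝
      rel   : (r : Rel) → All (ValOf Ufg Uoth) (map ⌜_⌝ (relArgs r)) → Bool

    Val : Srt → Set ℓ
    Val = ValOf Ufg Uoth

    Env : Ctx → Set ℓ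
    Env = All Val

  -- the remaining part of a model extending a pre-model:
  -- interpretations of the inductive relations and of the support expressions
  record Interp (P : PreModel) : Set ℓ where
    open PreModel P
    field
      ind : (i : Ind) → Env (map ⌜_⌝ (indArgs i)) → Bool
      sp  : ∀ {Γ} → SpExpr Γ → Env Γ → Ufg → Bool

  record Model : Set (lsuc ℓ) where
    field
      pre    : PreModel
      interp : Interp pre

module Eval (S : Signature) (ρ : Syntax.IndDefs S) {ℓ : Level}
            (em : ExcludedMiddle ℓ)
            (P : Models.PreModel S {ℓ}) (I : Models.Interp S P) where
  open Signature S
  open Syntax S
  open Models S {ℓ}
  open PreModel P
  open Interp I

  Holds : Bool → Set ℓ
  Holds b = Lift ℓ (T b)

  Empty : Set ℓ
  Empty = Lift ℓ ⊥

  lookupV : ∀ {Γ s} → Env Γ → Γ ∋ s → Val s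
  lookupV (v ∷ ν) here      = v
  lookupV (v ∷ ν) (there x) = lookupV ν x

  EqV : (s : Srt) → Val s → Val s → Set ℓ
  EqV fg      a b = a ≡ b
  EqV bg      a b = ∀ x → a x ≡ b x
  EqV (oth k) a b = a ≡ b

  mutual
    ⟦_⟧t : ∀ {Γ s} → Term Γ s → Env Γ → Val s
    ⟦ con c ⟧t ν      = const c
    ⟦ var x ⟧t ν      = lookupV ν x
    ⟦ app f ts ⟧t ν   = fun f (⟦ ts ⟧ts ν)
    ⟦ tite γ t u ⟧t ν = if does (em {G⟦ γ ⟧ ν}) then ⟦ t ⟧t ν else ⟦ u ⟧t ν
    ⟦ spF φ ⟧t ν      = sp (sF φ) ν
    ⟦ spT t ⟧t ν      = sp (sT t) ν
    ⟦ emp ⟧t ν        = λ _ → false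
    ⟦ uni a b ⟧t ν    = λ x → ⟦ a ⟧t ν x ∨ ⟦ b ⟧t ν x
    ⟦ int a b ⟧t ν    = λ x → ⟦ a ⟧t ν x ∧ ⟦ b ⟧t ν x
    ⟦ cmp a ⟧t ν      = λ x → not (⟦ a ⟧t ν x)

    ⟦_⟧ts : ∀ {Γ Δ} → Terms Γ Δ → Env Γ → Env Δ
    ⟦ [] ⟧ts ν     = []
    ⟦ t ∷ ts ⟧ts ν = ⟦ t ⟧t ν ∷ ⟦ ts ⟧ts ν

    G⟦_⟧ : ∀ {Γ} → Guard Γ → Env Γ → Set ℓ
    G⟦ geq t u ⟧ ν    = ⟦ t ⟧t ν ≡ ⟦ u ⟧t ν
    G⟦ grel r ts ⟧ ν  = Holds (rel r (⟦ ts ⟧ts ν))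
    G⟦ gand γ δ ⟧ ν   = G⟦ γ ⟧ ν × G⟦ δ ⟧ ν
    G⟦ gneg γ ⟧ ν     = ¬ G⟦ γ ⟧ ν
    G⟦ gite γ δ ε ⟧ ν = (G⟦ γ ⟧ ν × G⟦ δ ⟧ ν) ⊎ (¬ G⟦ γ ⟧ ν × G⟦ ε ⟧ ν)
    G⟦ gex s γ δ ⟧ ν  = Σ[ v ∈ Val s ] (G⟦ γ ⟧ (v ∷ ν) × G⟦ δ ⟧ (v ∷ ν))

  F⟦_⟧ : ∀ {Γ} → Formula Γ → Env Γ → Set ℓ
  F⟦ feq {s} t u ⟧ ν = EqV s (⟦ t ⟧t ν) (⟦ u ⟧t ν)
  F⟦ frel r ts ⟧ ν   = Holds (rel r (⟦ ts ⟧ts ν))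
  F⟦ find i ts ⟧ ν   = Holds (ind i (⟦ ts ⟧ts ν))
  F⟦ fmem t a ⟧ ν    = Holds (⟦ a ⟧t ν (⟦ t ⟧t ν))
  F⟦ fand φ ψ ⟧ ν    = F⟦ φ ⟧ ν × F⟦ ψ ⟧ ν
  F⟦ fneg φ ⟧ ν      = ¬ F⟦ φ ⟧ ν
  F⟦ fite γ φ ψ ⟧ ν  = (G⟦ γ ⟧ ν × F⟦ φ ⟧ ν) ⊎ (¬ G⟦ γ ⟧ ν × F⟦ ψ ⟧ ν)
  F⟦ fex s γ φ ⟧ ν   = Σ[ v ∈ Val s ] (G⟦ γ ⟧ (v ∷ ν) × F⟦ φ ⟧ (v ∷ ν))

  InSp : ∀ {Γ} → SpExpr Γ → Env Γ → Ufg → Set ℓ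
  InSp e ν x = Holds (sp e ν x)

  FgArg : ∀ {Γ Δ} → Terms Γ Δ → Env Γ → Ufg → Set ℓ
  FgArg [] ν x                  = Empty
  FgArg (_∷_ {fg} t ts) ν x     = (⟦ t ⟧t ν ≡ x) ⊎ FgArg ts ν x
  FgArg (_∷_ {bg} t ts) ν x     = FgArg ts ν x
  FgArg (_∷_ {oth k} t ts) ν x  = FgArg ts ν x

  ArgSp : ∀ {Γ Δ} → Terms Γ Δ → Env Γ → Ufg → Set ℓ
  ArgSp [] ν x       = Empty
  ArgSp (t ∷ ts) ν x = InSp (sT t) ν x ⊎ ArgSp ts ν x

  SpRHS : ∀ {Γ} → SpExpr Γ → Env Γ → Ufg → Set ℓ
  SpRHS (sT (con c)) ν x      = Empty
  SpRHS (sT (var y)) ν x      = Empty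
  SpRHS (sT (app f ts)) ν x   =
    if mutable f then (FgArg ts ν x ⊎ ArgSp ts ν x) else ArgSp ts ν x
  SpRHS (sT (tite γ t u)) ν x =
    InSp (sF ⌊ γ ⌋) ν x ⊎
    (if does (em {G⟦ γ ⟧ ν}) then InSp (sT t) ν x else InSp (sT u) ν x)
  SpRHS (sT (spF φ)) ν x      = InSp (sF φ) ν x
  SpRHS (sT (spT t)) ν x      = InSp (sT t) ν x
  SpRHS (sT emp) ν x          = Empty
  SpRHS (sT (uni a b)) ν x    = InSp (sT a) ν x ⊎ InSp (sT b) ν x
  SpRHS (sT (int a b)) ν x    = InSp (sT a) ν x ⊎ InSp (sT b) ν x
  SpRHS (sT (cmp a)) ν x      = InSp (sT a) ν x
  SpRHS (sF (feq t u)) ν x    = InSp (sT t) ν x ⊎ InSp (sT u) ν x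
  SpRHS (sF (frel r ts)) ν x  = ArgSp ts ν x
  SpRHS (sF (find i ts)) ν x  = InSp (sF (ρ i)) (⟦ ts ⟧ts ν) x ⊎ ArgSp ts ν x
  SpRHS (sF (fmem t a)) ν x   = InSp (sT t) ν x ⊎ InSp (sT a) ν x
  SpRHS (sF (fand φ ψ)) ν x   = InSp (sF φ) ν x ⊎ InSp (sF ψ) ν x
  SpRHS (sF (fneg φ)) ν x     = InSp (sF φ) ν x
  SpRHS (sF (fite γ φ ψ)) ν x =
    InSp (sF ⌊ γ ⌋) ν x ⊎
    (if does (em {G⟦ γ ⟧ ν}) then InSp (sF φ) ν x else InSp (sF ψ) ν x)
  SpRHS (sF (fex s γ φ)) ν x  =
    (Σ[ v ∈ Val s ] InSp (sF ⌊ γ ⌋) (v ∷ ν) x) ⊎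
    (Σ[ v ∈ Val s ] (G⟦ γ ⟧ (v ∷ ν) × InSp (sF φ) (v ∷ ν) x))

-- Frame models over a fixed pre-model  (Mod(M̂) = Interp P)

module Frame (S : Signature) (ρ : Syntax.IndDefs S) {ℓ : Level}
             (em : ExcludedMiddle ℓ) (P : Models.PreModel S {ℓ}) where
  open Signature S
  open Syntax S
  open Models S {ℓ}
  open PreModel P
  open Interp

  module E = Eval S ρ em P

  SupportEqs : Interp P → Set ℓ
  SupportEqs I = ∀ {Γ} (e : SpExpr Γ) (ν : Env Γ) (x : Ufg) →
                 E.Holds I (sp I e ν x) ⇔ E.SpRHS I e ν x

  InductiveEqs : Interp P → Set ℓ
  InductiveEqs I = ∀ (i : Ind) (vs : Env (map ⌜_⌝ (indArgs i))) →
                   E.Holds I (ind I i vs) ⇔ E.F⟦_⟧ I (ρ i) vs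

  _≤f_ : Interp P → Interp P → Set ℓ
  I ≤f J = ∀ {Γ} (e : SpExpr Γ) (ν : Env Γ) (x : Ufg) →
           E.Holds I (sp I e ν x) → E.Holds J (sp J e ν x)

  _<f_ : Interp P → Interp P → Set ℓ
  I <f J = (I ≤f J) × ¬ (J ≤f I)

  SameSp : Interp P → Interp P → Set ℓ
  SameSp I J = ∀ {Γ} (e : SpExpr Γ) (ν : Env Γ) (x : Ufg) → sp I e ν x ≡ sp J e ν x

  _≤i_ : Interp P → Interp P → Set ℓ
  I ≤i J = SameSp I J ×
           (∀ (i : Ind) (vs : Env (map ⌜_⌝ (indArgs i))) →
              E.Holds I (ind I i vs) → E.Holds J (ind J i vs))

  _<i_ : Interp P → Interp P → Set ℓ
  I <i J = (I ≤i J) × ¬ (J ≤i I)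

  IsFrameModel : Interp P → Set ℓ
  IsFrameModel I = SupportEqs I × InductiveEqs I
                 × (∀ J → J <f I → ¬ SupportEqs J)
                 × (∀ J → J <i I → ¬ InductiveEqs J)

  SameInterp : Interp P → Interp P → Set ℓ
  SameInterp I J = SameSp I J ×
                   (∀ (i : Ind) (vs : Env (map ⌜_⌝ (indArgs i))) → ind I i vs ≡ ind J i vs)

module Submission where

-- Fix a pre-model P.  An interpretation of the support expressions is a
-- predicate on triples (e, ν, x), and the support equations say that it is a
-- fixed point of the operator sending a predicate X to the right-hand sides
-- of the support equations computed with X.  This operator is monotone,
-- because terms of non-background sort and guards never mention support
-- expressions or inductive relations.  Likewise, once the supports are
-- fixed, the inductive equations ask for a fixed point of a monotone
-- operator on the inductive relations (monotone because inductive relations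
-- occur only positively in their definitions).
--
-- So the proof consists of: (1) a classical Knaster–Tarski theorem giving
-- least fixed points of monotone operators on Bool-valued predicates;
-- (2) independence and monotonicity facts about the semantics; (3) the
-- model I₀ built from the two least fixed points, which is a frame model
-- because every solution of the equations lies above it, and is the only
-- one because a frame model not below I₀ would contradict its own minimality.

open import Defs
open import Level using (Level; Lift; lift; lower)
open import Data.Product using (_×_; Σ-syntax; _,_; proj₂)
open import Axiom.ExcludedMiddle using (ExcludedMiddle)
open import Axiom.DoubleNegationElimination using (em⇒dne)
open import Data.Bool using (Bool; true; false; T; if_then_else_; _∨_; _∧_; not)
open import Data.Unit using (⊤; tt)
open import Data.Empty using (⊥; ⊥-elim)
open import Data.Sum using (inj₁; inj₂) renaming (map to map-⊎)
open import Data.List using (List; []; _∷_; map)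
open import Data.List.Relation.Unary.All using (All; []; _∷_)
open import Relation.Nullary using (¬_; yes; no; does)
open import Relation.Nullary.Decidable using (does-⇔)
open import Relation.Binary.PropositionalEquality using (_≡_; refl; sym; trans; cong; cong₂; subst)
open import Function.Bundles using (_⇔_; mk⇔; Equivalence)

module Classical {ℓ : Level} (em : ExcludedMiddle ℓ) where

  Holds : Bool → Set ℓ
  Holds b = Lift ℓ (T b)

  decide-sound : {A : Set ℓ} → Holds (does (em {A})) → A
  decide-sound {A} h with em {A}
  ... | yes a = a
  ... | no _  = ⊥-elim (lower h)

  decide-complete : {A : Set ℓ} → A → Holds (does (em {A}))
  decide-complete {A} a with em {A}
  ... | yes _ = lift tt
  ... | no ¬a = ⊥-elim (¬a a)

  Bool-ext : {a b : Bool} → (Holds a → Holds b) → (Holds b → Holds a) → a ≡ b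
  Bool-ext {false} {false} _ _ = refl
  Bool-ext {false} {true}  _ g = ⊥-elim (lower (g (lift tt)))
  Bool-ext {true}  {false} f _ = ⊥-elim (lower (f (lift tt)))
  Bool-ext {true}  {true}  _ _ = refl

  -- Knaster–Tarski: a monotone operator F on predicates over A has a least
  -- fixed point, the intersection of all its pre-fixed points.
  module LeastFixedPoint {A : Set ℓ} (F : (A → Bool) → A → Set ℓ)
      (mono : ∀ X Y → (∀ a → Holds (X a) → Holds (Y a)) → ∀ a → F X a → F Y a) where

    PreFixed : (A → Bool) → Set ℓ
    PreFixed X = ∀ a → F X a → Holds (X a)

    lfp : A → Bool
    lfp a = does (em {(X : A → Bool) → PreFixed X → Holds (X a)})

    lfp-least : ∀ X → PreFixed X → ∀ a → Holds (lfp a) → Holds (X a)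
    lfp-least X pre a h = decide-sound h X pre

    lfp-prefixed : PreFixed lfp
    lfp-prefixed a h =
      decide-complete (λ X pre → pre a (mono lfp X (lfp-least X pre) a h))

    -- the image of lfp under F is again pre-fixed, hence contains lfp
    lfp-postfixed : ∀ a → Holds (lfp a) → F lfp a
    lfp-postfixed a h = decide-sound (lfp-least image image-prefixed a h)
      where
        image : A → Bool
        image b = does (em {F lfp b})

        image-prefixed : PreFixed image
        image-prefixed b fb = decide-complete
          (mono image lfp (λ c hc → lfp-prefixed c (decide-sound hc)) b fb)

    lfp-fixed : ∀ a → Holds (lfp a) ⇔ F lfp a
    lfp-fixed a = mk⇔ (lfp-postfixed a) (lfp-prefixed a)

module Semantics {ℓ : Level} (em : ExcludedMiddle ℓ) (S : Signature)
                 (ρ : Syntax.IndDefs S) (P : Models.PreModel S {ℓ}) where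
  open Classical em
  open Signature S
  open Syntax S
  open Models S {ℓ}
  open PreModel P
  open Interp
  open Frame S ρ em P

  NotBg : Srt → Set
  NotBg fg      = ⊤
  NotBg bg      = ⊥
  NotBg (oth _) = ⊤

  notBg : (o : OSort nOth) → NotBg ⌜ o ⌝
  notBg ofg      = tt
  notBg (ooth _) = tt

  notBgs : (os : List (OSort nOth)) → All NotBg (map ⌜_⌝ os)
  notBgs []       = []
  notBgs (o ∷ os) = notBg o ∷ notBgs os

  if-cong : ∀ {a} {A : Set a} {b b' : Bool} {x x' y y' : A} → b ≡ b' → x ≡ x' → y ≡ y' →
            (if b then x else y) ≡ (if b' then x' else y')
  if-cong {b = b} refl = cong₂ (if_then_else_ b)

  lookup-indep : ∀ (I J : Interp P) {Γ s} (ν : Env Γ) (y : Γ ∋ s) →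
                 E.lookupV I ν y ≡ E.lookupV J ν y
  lookup-indep I J (v ∷ ν) here      = refl
  lookup-indep I J (v ∷ ν) (there y) = lookup-indep I J ν y

  -- Terms of non-background sort and guards contain no support expressions
  -- and no inductive relations, so their meaning does not depend on the
  -- interpretation of these.
  mutual
    term-indep : ∀ (I J : Interp P) {Γ s} (t : Term Γ s) → NotBg s → (ν : Env Γ) →
                 E.⟦_⟧t I t ν ≡ E.⟦_⟧t J t ν
    term-indep I J (con c)      _  ν = refl
    term-indep I J (var y)      _  ν = lookup-indep I J ν y
    term-indep I J (app f ts)   _  ν = cong (fun f) (terms-indep I J ts (notBgs (funArgs f)) ν)
    term-indep I J (tite γ t u) nb ν =
      if-cong (guard-decision-indep I J γ ν) (term-indep I J t nb ν) (term-indep I J u nb ν)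

    terms-indep : ∀ (I J : Interp P) {Γ ss} (ts : Terms Γ ss) → All NotBg ss → (ν : Env Γ) →
                  E.⟦_⟧ts I ts ν ≡ E.⟦_⟧ts J ts ν
    terms-indep I J []       _        ν = refl
    terms-indep I J (t ∷ ts) (p ∷ ps) ν = cong₂ _∷_ (term-indep I J t p ν) (terms-indep I J ts ps ν)

    guard-transfer : ∀ (I J : Interp P) {Γ} (γ : Guard Γ) (ν : Env Γ) →
                     E.G⟦_⟧ I γ ν → E.G⟦_⟧ J γ ν
    guard-transfer I J (geq {o} t u) ν e =
      trans (sym (term-indep I J t (notBg o) ν)) (trans e (term-indep I J u (notBg o) ν))
    guard-transfer I J (grel r ts) ν h =
      subst (λ vs → Holds (rel r vs)) (terms-indep I J ts (notBgs (relArgs r)) ν) h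
    guard-transfer I J (gand γ δ) ν (g , d) = guard-transfer I J γ ν g , guard-transfer I J δ ν d
    guard-transfer I J (gneg γ) ν ¬g g = ¬g (guard-transfer J I γ ν g)
    guard-transfer I J (gite γ δ ε) ν (inj₁ (g , d)) =
      inj₁ (guard-transfer I J γ ν g , guard-transfer I J δ ν d)
    guard-transfer I J (gite γ δ ε) ν (inj₂ (¬g , d)) =
      inj₂ ((λ g → ¬g (guard-transfer J I γ ν g)) , guard-transfer I J ε ν d)
    guard-transfer I J (gex s γ δ) ν (v , g , d) =
      v , guard-transfer I J γ (v ∷ ν) g , guard-transfer I J δ (v ∷ ν) d

    guard-decision-indep : ∀ (I J : Interp P) {Γ} (γ : Guard Γ) (ν : Env Γ) →
                           does (em {E.G⟦_⟧ I γ ν}) ≡ does (em {E.G⟦_⟧ J γ ν})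
    guard-decision-indep I J γ ν =
      does-⇔ (mk⇔ (guard-transfer I J γ ν) (guard-transfer J I γ ν)) em em

  SameSp-sym : ∀ {I J} → SameSp I J → SameSp J I
  SameSp-sym same e ν x = sym (same e ν x)

  SameSp⇒≤f : ∀ {I J} → SameSp I J → I ≤f J
  SameSp⇒≤f same e ν x = subst Holds (same e ν x)

  SameVal : (s : Srt) → Val s → Val s → Set ℓ
  SameVal fg      a b = a ≡ b
  SameVal bg      a b = ∀ x → a x ≡ b x
  SameVal (oth k) a b = a ≡ b

  SameVal-≡ : ∀ s {a b : Val s} → a ≡ b → SameVal s a b
  SameVal-≡ fg      refl = refl
  SameVal-≡ bg      refl = λ _ → refl
  SameVal-≡ (oth k) refl = refl

  SameVal-if : ∀ s {b b' : Bool} {x y x' y' : Val s} → b ≡ b' → SameVal s x x' → SameVal s y y' →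
               SameVal s (if b then x else y) (if b' then x' else y')
  SameVal-if s {true}  refl p _ = p
  SameVal-if s {false} refl _ q = q

  EqV-transfer : ∀ (I J : Interp P) s {a b a' b' : Val s} → SameVal s a a' → SameVal s b b' →
                 E.EqV I s a b → E.EqV J s a' b'
  EqV-transfer I J fg      p q e = trans (sym p) (trans e q)
  EqV-transfer I J bg      p q e = λ x → trans (sym (p x)) (trans (e x) (q x))
  EqV-transfer I J (oth k) p q e = trans (sym p) (trans e q)

  term-cong : ∀ (I J : Interp P) → SameSp I J → ∀ {Γ s} (t : Term Γ s) (ν : Env Γ) →
              SameVal s (E.⟦_⟧t I t ν) (E.⟦_⟧t J t ν)
  term-cong I J same (con c)      ν = SameVal-≡ _ refl
  term-cong I J same (var y)      ν = SameVal-≡ _ (lookup-indep I J ν y)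
  term-cong I J same (app f ts)   ν =
    SameVal-≡ _ (cong (fun f) (terms-indep I J ts (notBgs (funArgs f)) ν))
  term-cong I J same {s = s} (tite γ t u) ν =
    SameVal-if s (guard-decision-indep I J γ ν) (term-cong I J same t ν) (term-cong I J same u ν)
  term-cong I J same (spF φ)   ν = same (sF φ) ν
  term-cong I J same (spT t)   ν = same (sT t) ν
  term-cong I J same emp       ν = λ _ → refl
  term-cong I J same (uni a b) ν = λ x → cong₂ _∨_ (term-cong I J same a ν x) (term-cong I J same b ν x)
  term-cong I J same (int a b) ν = λ x → cong₂ _∧_ (term-cong I J same a ν x) (term-cong I J same b ν x)
  term-cong I J same (cmp a)   ν = λ x → cong not (term-cong I J same a ν x)

  membership-transfer : ∀ (I J : Interp P) → SameSp I J → ∀ {Γ} (t : Term Γ fg) (a : Term Γ bg)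
                        (ν : Env Γ) → E.F⟦_⟧ I (fmem t a) ν → E.F⟦_⟧ J (fmem t a) ν
  membership-transfer I J same t a ν = subst Holds
    (trans (cong (E.⟦_⟧t I a ν) (term-indep I J t tt ν)) (term-cong I J same a ν (E.⟦_⟧t J t ν)))

  IndLe : Interp P → Interp P → Set ℓ
  IndLe I J = ∀ i vs → Holds (ind I i vs) → Holds (ind J i vs)

  mutual
    formula-mono : ∀ (I J : Interp P) → SameSp I J → IndLe I J → ∀ {Γ} (φ : Formula Γ) →
                   Occ pos φ → (ν : Env Γ) → E.F⟦_⟧ I φ ν → E.F⟦_⟧ J φ ν
    formula-mono I J same le (feq {s} t u) _ ν e =
      EqV-transfer I J s (term-cong I J same t ν) (term-cong I J same u ν) e
    formula-mono I J same le (frel r ts) _ ν h =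
      subst (λ vs → Holds (rel r vs)) (terms-indep I J ts (notBgs (relArgs r)) ν) h
    formula-mono I J same le (find i ts) _ ν h =
      le i _ (subst (λ vs → Holds (ind I i vs)) (terms-indep I J ts (notBgs (indArgs i)) ν) h)
    formula-mono I J same le (fmem t a) _ ν h = membership-transfer I J same t a ν h
    formula-mono I J same le (fand φ ψ) (oφ , oψ) ν (a , b) =
      formula-mono I J same le φ oφ ν a , formula-mono I J same le ψ oψ ν b
    formula-mono I J same le (fneg φ) o ν ¬a a = ¬a (formula-anti I J same le φ o ν a)
    formula-mono I J same le (fite γ φ ψ) (oφ , _) ν (inj₁ (g , a)) =
      inj₁ (guard-transfer I J γ ν g , formula-mono I J same le φ oφ ν a)
    formula-mono I J same le (fite γ φ ψ) (_ , oψ) ν (inj₂ (¬g , b)) =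
      inj₂ ((λ g → ¬g (guard-transfer J I γ ν g)) , formula-mono I J same le ψ oψ ν b)
    formula-mono I J same le (fex s γ φ) o ν (v , g , a) =
      v , guard-transfer I J γ (v ∷ ν) g , formula-mono I J same le φ o (v ∷ ν) a

    formula-anti : ∀ (I J : Interp P) → SameSp I J → IndLe I J → ∀ {Γ} (φ : Formula Γ) →
                   Occ neg φ → (ν : Env Γ) → E.F⟦_⟧ J φ ν → E.F⟦_⟧ I φ ν
    formula-anti I J same le (feq {s} t u) _ ν e =
      EqV-transfer J I s (term-cong J I (SameSp-sym {I} {J} same) t ν) (term-cong J I (SameSp-sym {I} {J} same) u ν) e
    formula-anti I J same le (frel r ts) _ ν h =
      subst (λ vs → Holds (rel r vs)) (terms-indep J I ts (notBgs (relArgs r)) ν) h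
    formula-anti I J same le (find i ts) () ν h
    formula-anti I J same le (fmem t a) _ ν h = membership-transfer J I (SameSp-sym {I} {J} same) t a ν h
    formula-anti I J same le (fand φ ψ) (oφ , oψ) ν (a , b) =
      formula-anti I J same le φ oφ ν a , formula-anti I J same le ψ oψ ν b
    formula-anti I J same le (fneg φ) o ν ¬a a = ¬a (formula-mono I J same le φ o ν a)
    formula-anti I J same le (fite γ φ ψ) (oφ , _) ν (inj₁ (g , a)) =
      inj₁ (guard-transfer J I γ ν g , formula-anti I J same le φ oφ ν a)
    formula-anti I J same le (fite γ φ ψ) (_ , oψ) ν (inj₂ (¬g , b)) =
      inj₂ ((λ g → ¬g (guard-transfer I J γ ν g)) , formula-anti I J same le ψ oψ ν b)
    formula-anti I J same le (fex s γ φ) o ν (v , g , a) =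
      v , guard-transfer J I γ (v ∷ ν) g , formula-anti I J same le φ o (v ∷ ν) a

  FgArg-transfer : ∀ (I J : Interp P) {Γ Δ} (ts : Terms Γ Δ) (ν : Env Γ) x →
                   E.FgArg I ts ν x → E.FgArg J ts ν x
  FgArg-transfer I J [] ν x (lift ())
  FgArg-transfer I J (_∷_ {fg} t ts) ν x (inj₁ e) = inj₁ (trans (sym (term-indep I J t tt ν)) e)
  FgArg-transfer I J (_∷_ {fg} t ts) ν x (inj₂ h) = inj₂ (FgArg-transfer I J ts ν x h)
  FgArg-transfer I J (_∷_ {bg} t ts) ν x h = FgArg-transfer I J ts ν x h
  FgArg-transfer I J (_∷_ {oth k} t ts) ν x h = FgArg-transfer I J ts ν x h

  ArgSp-mono : ∀ (I J : Interp P) → I ≤f J → ∀ {Γ Δ} (ts : Terms Γ Δ) (ν : Env Γ) x →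
               E.ArgSp I ts ν x → E.ArgSp J ts ν x
  ArgSp-mono I J le [] ν x (lift ())
  ArgSp-mono I J le (t ∷ ts) ν x (inj₁ h) = inj₁ (le (sT t) ν x h)
  ArgSp-mono I J le (t ∷ ts) ν x (inj₂ h) = inj₂ (ArgSp-mono I J le ts ν x h)

  if-map : {b b' : Bool} {A A' B B' : Set ℓ} → b ≡ b' → (A → A') → (B → B') →
           (if b then A else B) → (if b' then A' else B')
  if-map {true}  refl f _ = f
  if-map {false} refl _ g = g

  rhs-mono : ∀ (I J : Interp P) → I ≤f J → ∀ {Γ} (e : SpExpr Γ) (ν : Env Γ) x →
             E.SpRHS I e ν x → E.SpRHS J e ν x
  rhs-mono I J le (sT (con c)) ν x (lift ())
  rhs-mono I J le (sT (var y)) ν x (lift ())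
  rhs-mono I J le (sT (app f ts)) ν x h with mutable f
  ... | true  = map-⊎ (FgArg-transfer I J ts ν x) (ArgSp-mono I J le ts ν x) h
  ... | false = ArgSp-mono I J le ts ν x h
  rhs-mono I J le (sT (tite γ t u)) ν x (inj₁ h) = inj₁ (le (sF ⌊ γ ⌋) ν x h)
  rhs-mono I J le (sT (tite γ t u)) ν x (inj₂ h) =
    inj₂ (if-map (guard-decision-indep I J γ ν) (le (sT t) ν x) (le (sT u) ν x) h)
  rhs-mono I J le (sT (spF φ)) ν x h = le (sF φ) ν x h
  rhs-mono I J le (sT (spT t)) ν x h = le (sT t) ν x h
  rhs-mono I J le (sT emp) ν x (lift ())
  rhs-mono I J le (sT (uni a b)) ν x h = map-⊎ (le (sT a) ν x) (le (sT b) ν x) h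
  rhs-mono I J le (sT (int a b)) ν x h = map-⊎ (le (sT a) ν x) (le (sT b) ν x) h
  rhs-mono I J le (sT (cmp a)) ν x h = le (sT a) ν x h
  rhs-mono I J le (sF (feq t u)) ν x h = map-⊎ (le (sT t) ν x) (le (sT u) ν x) h
  rhs-mono I J le (sF (frel r ts)) ν x h = ArgSp-mono I J le ts ν x h
  rhs-mono I J le (sF (find i ts)) ν x (inj₁ h) =
    inj₁ (subst (λ vs → Holds (sp J (sF (ρ i)) vs x))
                (terms-indep I J ts (notBgs (indArgs i)) ν) (le (sF (ρ i)) _ x h))
  rhs-mono I J le (sF (find i ts)) ν x (inj₂ h) = inj₂ (ArgSp-mono I J le ts ν x h)
  rhs-mono I J le (sF (fmem t a)) ν x h = map-⊎ (le (sT t) ν x) (le (sT a) ν x) h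
  rhs-mono I J le (sF (fand φ ψ)) ν x h = map-⊎ (le (sF φ) ν x) (le (sF ψ) ν x) h
  rhs-mono I J le (sF (fneg φ)) ν x h = le (sF φ) ν x h
  rhs-mono I J le (sF (fite γ φ ψ)) ν x (inj₁ h) = inj₁ (le (sF ⌊ γ ⌋) ν x h)
  rhs-mono I J le (sF (fite γ φ ψ)) ν x (inj₂ h) =
    inj₂ (if-map (guard-decision-indep I J γ ν) (le (sF φ) ν x) (le (sF ψ) ν x) h)
  rhs-mono I J le (sF (fex s γ φ)) ν x (inj₁ (v , h)) = inj₁ (v , le (sF ⌊ γ ⌋) (v ∷ ν) x h)
  rhs-mono I J le (sF (fex s γ φ)) ν x (inj₂ (v , g , h)) =
    inj₂ (v , guard-transfer I J γ (v ∷ ν) g , le (sF φ) (v ∷ ν) x h)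

module LeastSolution {ℓ : Level} (em : ExcludedMiddle ℓ) (S : Signature)
                     (ρ : Syntax.IndDefs S) (positive : Syntax.Positive S ρ)
                     (P : Models.PreModel S {ℓ}) where
  open Classical em
  open Signature S
  open Syntax S
  open Models S {ℓ}
  open PreModel P
  open Interp
  open Frame S ρ em P
  open Semantics em S ρ P

  SpIndex : Set ℓ
  SpIndex = Σ[ Γ ∈ Ctx ] (SpExpr Γ × Env Γ × Ufg)

  IndIndex : Set ℓ
  IndIndex = Σ[ i ∈ Ind ] Env (map ⌜_⌝ (indArgs i))

  interp : (SpIndex → Bool) → (IndIndex → Bool) → Interp P
  interp X Y = record { ind = λ i vs → Y (i , vs) ; sp = λ e ν x → X (_ , e , ν , x) }

  spOf : Interp P → SpIndex → Bool
  spOf J (_ , e , ν , x) = sp J e ν x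

  indOf : Interp P → IndIndex → Bool
  indOf J (i , vs) = ind J i vs

  -- the support equations do not involve the inductive relations
  rhs-transfer : ∀ I J → SameSp I J → ∀ {Γ} (e : SpExpr Γ) ν x → E.SpRHS I e ν x → E.SpRHS J e ν x
  rhs-transfer I J same = rhs-mono I J (SameSp⇒≤f {I} {J} same)

  noInd : IndIndex → Bool
  noInd _ = false

  SupportOp : (SpIndex → Bool) → SpIndex → Set ℓ
  SupportOp X (_ , e , ν , x) = E.SpRHS (interp X noInd) e ν x

  SupportOp-mono : ∀ X Y → (∀ a → Holds (X a) → Holds (Y a)) → ∀ a → SupportOp X a → SupportOp Y a
  SupportOp-mono X Y le (_ , e , ν , x) =
    rhs-mono (interp X noInd) (interp Y noInd) (λ e' ν' x' → le (_ , e' , ν' , x')) e ν x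

  module SpFix = LeastFixedPoint SupportOp SupportOp-mono

  sp₀ : SpIndex → Bool
  sp₀ = SpFix.lfp

  -- with the supports fixed to sp₀, the inductive equations form a monotone
  -- operator because inductive relations occur positively in ρ
  InductiveOp : (IndIndex → Bool) → IndIndex → Set ℓ
  InductiveOp Y (i , vs) = E.F⟦_⟧ (interp sp₀ Y) (ρ i) vs

  InductiveOp-mono : ∀ X Y → (∀ a → Holds (X a) → Holds (Y a)) → ∀ a → InductiveOp X a → InductiveOp Y a
  InductiveOp-mono X Y le (i , vs) =
    formula-mono (interp sp₀ X) (interp sp₀ Y) (λ _ _ _ → refl) (λ i' vs' → le (i' , vs')) (ρ i) (positive i) vs

  module IndFix = LeastFixedPoint InductiveOp InductiveOp-mono

  I₀ : Interp P
  I₀ = interp sp₀ IndFix.lfp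

  I₀-support : SupportEqs I₀
  I₀-support e ν x = mk⇔
    (λ h → rhs-transfer (interp sp₀ noInd) I₀ (λ _ _ _ → refl) e ν x (SpFix.lfp-postfixed _ h))
    (λ r → SpFix.lfp-prefixed _ (rhs-transfer I₀ (interp sp₀ noInd) (λ _ _ _ → refl) e ν x r))

  I₀-inductive : InductiveEqs I₀
  I₀-inductive i vs = IndFix.lfp-fixed (i , vs)

  support-least : ∀ J → SupportEqs J → I₀ ≤f J
  support-least J eqs e ν x = SpFix.lfp-least (spOf J) prefixed (_ , e , ν , x)
    where
      prefixed : SpFix.PreFixed (spOf J)
      prefixed (_ , e' , ν' , x') r =
        Equivalence.from (eqs e' ν' x') (rhs-transfer (interp (spOf J) noInd) J (λ _ _ _ → refl) e' ν' x' r)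

  inductive-least : ∀ J → SameSp I₀ J → InductiveEqs J → IndLe I₀ J
  inductive-least J same eqs i vs = IndFix.lfp-least (indOf J) prefixed (i , vs)
    where
      prefixed : IndFix.PreFixed (indOf J)
      prefixed (i' , vs') f = Equivalence.from (eqs i' vs')
        (formula-mono (interp sp₀ (indOf J)) J same (λ _ _ h → h) (ρ i') (positive i') vs' f)

  I₀-frame : IsFrameModel I₀
  I₀-frame = I₀-support , I₀-inductive , minimal-support , minimal-inductive
    where
      minimal-support : ∀ J → J <f I₀ → ¬ SupportEqs J
      minimal-support J (_ , I₀≰J) eqs = I₀≰J (support-least J eqs)

      minimal-inductive : ∀ J → J <i I₀ → ¬ InductiveEqs J
      minimal-inductive J ((sameJI₀ , _) , I₀≰J) eqs =
        I₀≰J (same , inductive-least J same eqs)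
        where same = SameSp-sym {J} {I₀} sameJI₀

  -- A frame model J lies above I₀ by leastness, and cannot lie strictly
  -- above it since I₀ solves the equations and J is minimal; so J = I₀.
  frame-unique : ∀ J → IsFrameModel J → SameInterp I₀ J
  frame-unique J (J-support , J-inductive , J-minimal-support , J-minimal-inductive) =
    same-sp , λ i vs → Bool-ext (proj₂ I₀≤iJ i vs) (proj₂ J≤iI₀ i vs)
    where
      I₀≤J : I₀ ≤f J
      I₀≤J = support-least J J-support

      J≤I₀ : J ≤f I₀
      J≤I₀ = em⇒dne em (λ J≰I₀ → J-minimal-support I₀ (I₀≤J , J≰I₀) I₀-support)

      same-sp : SameSp I₀ J
      same-sp e ν x = Bool-ext (I₀≤J e ν x) (J≤I₀ e ν x)

      I₀≤iJ : I₀ ≤i J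
      I₀≤iJ = same-sp , inductive-least J same-sp J-inductive

      J≤iI₀ : J ≤i I₀
      J≤iI₀ = em⇒dne em (λ J≰I₀ → J-minimal-inductive I₀ (I₀≤iJ , J≰I₀) I₀-inductive)

proposition1 : ∀ {ℓ : Level} (em : ExcludedMiddle ℓ) →
    (S : Signature) (ρ : Syntax.IndDefs S) → Syntax.Positive S ρ →
    (M : Models.Model S {ℓ}) →
    Σ[ I ∈ Models.Interp S (Models.Model.pre M) ]
      (Frame.IsFrameModel S ρ em (Models.Model.pre M) I ×
       (∀ J → Frame.IsFrameModel S ρ em (Models.Model.pre M) J →
              Frame.SameInterp S ρ em (Models.Model.pre M) I J))
proposition1 em S ρ positive M = I₀ , I₀-frame , frame-unique
  where open LeastSolution em S ρ positive (Models.Model.pre M)
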